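{- Let $D$ be a $4$-anti-traceable oriented graph and let $P=v_1v_2\dots v_s$ be a longest anti-directed path in $D$. If $|V(P)|<|V(D)|$, then $v_1$ and $v_s$ are adjacent.
   Context: An oriented graph is a digraph obtained by orienting the edges of a simple undirected graph. An oriented path $x_1\dots x_p$ is anti-directed if every two consecutive arcs have opposite orientations. A digraph is anti-traceable if it has an anti-directed path through all its vertices, and $k$-anti-traceable if it has at least $k$ vertices and every induced subdigraph on $k$ vertices is anti-traceable. Two vertices are adjacent if there is an arc between them in either direction. -}

module Defs where

open import Data.Nat using (ℕ; _≤_)
open import Data.Fin using (Fin)
open import Data.Fin.Subset using (Subset; _∈_; ∣_∣)
open import Data.Bool using (Bool; true; false; not)
open import Data.List using (List; []; _∷_; length)
open import Data.List.Relation.Unary.Unique.Propositional using (Unique)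
import Data.List.Membership.Propositional as LM
open import Data.Product using (Σ; _×_; ∃)
open import Data.Sum using (_⊎_)
open import Data.Unit using (⊤)
open import Relation.Nullary using (¬_)
open import Relation.Binary.PropositionalEquality using (_≡_)
open import Function.Bundles using (_⇔_)

Arcs : ℕ → Set₁
Arcs n = Fin n → Fin n → Set

Oriented : ∀ {n} → Arcs n → Set
Oriented {n} A = (∀ (x : Fin n) → ¬ A x x) × (∀ (x y : Fin n) → A x y → ¬ A y x)

Adjacent : ∀ {n} → Arcs n → Fin n → Fin n → Set
Adjacent A x y = A x y ⊎ A y x

DirArc : ∀ {n} → Arcs n → Bool → Fin n → Fin n → Set
DirArc A true  x y = A x y
DirArc A false x y = A y x

Alternating : ∀ {n} → Arcs n → Bool → List (Fin n) → Set
Alternating A b []            = ⊤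
Alternating A b (x ∷ [])      = ⊤
Alternating A b (x ∷ y ∷ xs)  = DirArc A b x y × Alternating A (not b) (y ∷ xs)

AntiDirectedPath : ∀ {n} → Arcs n → List (Fin n) → Set
AntiDirectedPath A xs = Unique xs × Σ Bool (λ b → Alternating A b xs)

-- The induced subdigraph on S is anti-traceable: some anti-directed path
-- (using arcs of D, necessarily inside S) has vertex set exactly S.
AntiTraceableOn : ∀ {n} → Arcs n → Subset n → Set
AntiTraceableOn {n} A S =
  Σ (List (Fin n)) λ xs → AntiDirectedPath A xs × (∀ v → (v LM.∈ xs) ⇔ (v ∈ S))

KAntiTraceable : ∀ {n} → ℕ → Arcs n → Set
KAntiTraceable {n} k A = (k ≤ n) × (∀ (S : Subset n) → ∣ S ∣ ≡ k → AntiTraceableOn A S)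

-- Let u be a vertex off the longest path P = v₁ v₂ … w vₛ. Five placements of u next to
-- v₁, v₂, w, vₛ would give a longer anti-directed path, so the corresponding arc patterns are
-- absent from D. Each of the 4-sets {u,v₁,v₂,vₛ}, {u,v₁,w,vₛ}, {v₁,v₂,w,vₛ} has an anti-directed
-- Hamiltonian path; running through their possible shapes (with the arcs v₁v₂ and wvₛ known)
-- always produces an arc between v₁ and vₛ, a digon, or one of the excluded patterns.
module Submission where

open import Defs
open import Data.Nat using (ℕ; _≤_; _<_)
open import Data.List using (length)
open import Data.List.NonEmpty using (List⁺; toList; head; last)

open import Data.Nat using (zero; suc; z≤n; s≤s)
open import Data.Nat.Properties using (≤-antisym; 1+n≰n; <⇒≱) renaming (_≟_ to _≟ℕ_)
open import Data.Bool using (Bool; true; false; not)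
open import Data.Bool.Properties using (not-involutive)
open import Data.Fin using (Fin)
open import Data.Fin.Properties using (_≟_; ¬∀⟶∃¬)
open import Data.Fin.Subset using (Subset; ⁅_⁆; _∪_; ∣_∣; inside; outside) renaming (⊥ to ∅; _∈_ to _∈ₛ_)
open import Data.Vec.Base using (_∷_; here; there)
open import Data.Fin.Subset.Properties using (x∈p∪q⁻; x∈p∪q⁺; x∈⁅x⁆; x∈⁅y⁆⇒x≡y; ∉⊥; ∪-identityˡ; ∣⊥∣≡0)
open import Data.List using (List; []; _∷_; _++_; map; [_]; lookup; initLast; _∷ʳ′_; cartesianProductWith)
open import Data.List.Properties using (length-map; length-tabulate)
open import Data.List.NonEmpty using () renaming (_∷_ to _∷⁺_)
open import Data.List.Relation.Unary.All as All using (All; []; _∷_; all?)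
open import Data.List.Relation.Unary.All.Properties using (¬Any⇒All¬; ++⁻ˡ; ++⁻ʳ) renaming (++⁺ to All-++⁺)
open import Data.List.Relation.Unary.Any using (Any; here; there; any?)
open import Data.List.Relation.Unary.Unique.Propositional using (Unique; []; _∷_)
open import Data.List.Relation.Unary.Unique.Propositional.Properties using (map⁺; map⁻; allFin⁺)
open import Data.List.Relation.Binary.Subset.Propositional using (_⊆_)
open import Data.List.Membership.Propositional using (_∈_; _∉_)
open import Data.List.Membership.Propositional.Properties using (∈-∃++; ∈-map⁻; ∈-lookup; ∈-cartesianProductWith⁺)
import Data.List.Membership.DecPropositional as DecMembership
open import Data.List.Relation.Binary.Permutation.Propositional using (_↭_; ↭-refl; ↭-trans; ↭-sym; ↭-swap; ↭⇒↭ₛ; module PermutationReasoning)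
open import Data.List.Relation.Binary.Permutation.Propositional.Properties using (↭-length; shift; shifts; ++⁺ˡ; ↭-reverse)
open import Data.List.Relation.Binary.Permutation.Setoid.Properties using (Unique-resp-↭)
open import Data.Product using (∃; ∃₂; _×_; _,_; proj₁; proj₂; swap)
open import Data.Product.Properties using (≡-dec)
open import Data.Sum using (_⊎_; inj₁; inj₂)
open import Data.Unit using (tt)
open import Data.Empty using (⊥; ⊥-elim)
open import Relation.Nullary using (¬_; Dec)
open import Relation.Nullary.Decidable using (_⊎-dec_; _×-dec_; _→-dec_; from-yes; toWitness; True)
open import Relation.Binary.PropositionalEquality using (_≡_; _≢_; refl; cong; sym; trans; subst; setoid)
open import Function.Bundles using (Equivalence)

Longest : ∀ {n} → Arcs n → List (Fin n) → Set
Longest A P = ∀ Q → AntiDirectedPath A Q → length Q ≤ length P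

module _ {a} {X : Set a} where

  length-++-∷ : ∀ xs {ys : List X} {y} → length (xs ++ y ∷ ys) ≡ suc (length (xs ++ ys))
  length-++-∷ []       = refl
  length-++-∷ (x ∷ xs) = cong suc (length-++-∷ xs)

  ∈-++-∷⁻ : ∀ xs {ys : List X} {y z} → z ∈ xs ++ y ∷ ys → z ≢ y → z ∈ xs ++ ys
  ∈-++-∷⁻ []       (here z≡y) z≢y = ⊥-elim (z≢y z≡y)
  ∈-++-∷⁻ []       (there z∈) _   = z∈
  ∈-++-∷⁻ (x ∷ xs) (here z≡x) _   = here z≡x
  ∈-++-∷⁻ (x ∷ xs) (there z∈) z≢y = there (∈-++-∷⁻ xs z∈ z≢y)

  Unique⊆⇒length≤ : ∀ {xs ys : List X} → Unique xs → xs ⊆ ys → length xs ≤ length ys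
  Unique⊆⇒length≤ {[]}     _             _     = z≤n
  Unique⊆⇒length≤ {x ∷ xs} (x∉xs ∷ uxs) xs⊆ys with ∈-∃++ (xs⊆ys (here refl))
  ... | zs , zs′ , refl =
    subst (suc (length xs) ≤_) (sym (length-++-∷ zs))
      (s≤s (Unique⊆⇒length≤ uxs λ z∈xs →
        ∈-++-∷⁻ zs (xs⊆ys (there z∈xs)) λ z≡x → All.lookup x∉xs z∈xs (sym z≡x)))

  Unique-drop-middle : ∀ xs ys {zs : List X} → Unique (xs ++ ys ++ zs) → Unique (xs ++ zs)
  Unique-drop-middle []       []       u          = u
  Unique-drop-middle []       (y ∷ ys) (_ ∷ u)    = Unique-drop-middle [] ys u
  Unique-drop-middle (x ∷ xs) ys       (x∉ ∷ u) =
    All-++⁺ (++⁻ˡ xs x∉) (++⁻ʳ ys (++⁻ʳ xs x∉)) ∷ Unique-drop-middle xs ys u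

  lookup-injective : ∀ {xs : List X} → Unique xs → ∀ {i j} → lookup xs i ≡ lookup xs j → i ≡ j
  lookup-injective (_   ∷ _) {Fin.zero}  {Fin.zero}  _ = refl
  lookup-injective (x∉ ∷ _) {Fin.zero}  {Fin.suc j} e = ⊥-elim (All.lookup x∉ (∈-lookup j) e)
  lookup-injective (x∉ ∷ _) {Fin.suc i} {Fin.zero}  e = ⊥-elim (All.lookup x∉ (∈-lookup i) (sym e))
  lookup-injective (_   ∷ u) {Fin.suc i} {Fin.suc j} e = cong Fin.suc (lookup-injective u e)

  last-∷ : ∀ (x y : X) ys → last (x ∷⁺ y ∷ ys) ≡ last (y ∷⁺ ys)
  last-∷ x y ys with initLast ys
  ... | []       = refl
  ... | _ ∷ʳ′ _ = refl

  init-last₂ : ∀ (x y : X) zs → ∃₂ λ M w → x ∷ y ∷ zs ≡ M ++ w ∷ last (x ∷⁺ y ∷ zs) ∷ []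
  init-last₂ x y []       = [] , x , refl
  init-last₂ x y (z ∷ zs) with init-last₂ y z zs
  ... | M , w , eq = x ∷ M , w , cong (x ∷_) (trans eq (cong (λ v → M ++ w ∷ v ∷ []) (sym (last-∷ x y (z ∷ zs)))))

  four-ends : (P : List⁺ X) → 4 ≤ length (toList P) →
              ∃₂ λ v₂ M → ∃ λ w → toList P ≡ head P ∷ v₂ ∷ M ++ w ∷ last P ∷ []
  four-ends (v₁ ∷⁺ v₂ ∷ x₃ ∷ x₄ ∷ r) (s≤s (s≤s (s≤s (s≤s _)))) with init-last₂ x₃ x₄ r
  ... | M , w , eq =
    v₂ , M , w , cong (λ R → v₁ ∷ v₂ ∷ R)
      (trans eq (cong (λ v → M ++ w ∷ v ∷ []) (sym (trans (last-∷ v₁ v₂ (x₃ ∷ x₄ ∷ r)) (last-∷ v₂ x₃ (x₄ ∷ r))))))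

  ⊆-map⇒map : ∀ {b} {Y : Set b} {f : Y → X} xs {ys} → xs ⊆ map f ys →
              ∃ λ q → map f q ≡ xs × All (_∈ ys) q
  ⊆-map⇒map []       _      = [] , refl , []
  ⊆-map⇒map (x ∷ xs) xs⊆ys with ∈-map⁻ _ (xs⊆ys (here refl)) | ⊆-map⇒map xs (λ z∈ → xs⊆ys (there z∈))
  ... | y , y∈ys , refl | q , refl , q⊆ys = y ∷ q , refl , y∈ys ∷ q⊆ys

  words : ℕ → List X → List (List X)
  words zero    xs = [ [] ]
  words (suc k) xs = cartesianProductWith _∷_ xs (words k xs)

  ∈-words : ∀ {q} xs → All (_∈ xs) q → q ∈ words (length q) xs
  ∈-words xs []          = here refl
  ∈-words xs (x∈ ∷ q⊆) = ∈-cartesianProductWith⁺ _∷_ x∈ (∈-words xs q⊆)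

∃-∉ : ∀ {n} (xs : List (Fin n)) → length xs < n → ∃ λ v → v ∉ xs
∃-∉ {n} xs short = ¬∀⟶∃¬ n (_∈ xs) (λ v → DecMembership._∈?_ _≟_ v xs) λ all∈ →
  <⇒≱ short (subst (_≤ length xs) (length-tabulate (λ i → i))
              (Unique⊆⇒length≤ (allFin⁺ n) λ {v} _ → all∈ v))

fromList : ∀ {n} → List (Fin n) → Subset n
fromList []       = ∅
fromList (x ∷ xs) = ⁅ x ⁆ ∪ fromList xs

∈-fromList⁻ : ∀ {n} {v : Fin n} xs → v ∈ₛ fromList xs → v ∈ xs
∈-fromList⁻ []       v∈ = ⊥-elim (∉⊥ v∈)
∈-fromList⁻ (x ∷ xs) v∈ with x∈p∪q⁻ ⁅ x ⁆ (fromList xs) v∈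
... | inj₁ v∈x  = here (x∈⁅y⁆⇒x≡y x v∈x)
... | inj₂ v∈xs = there (∈-fromList⁻ xs v∈xs)

∈-fromList⁺ : ∀ {n} {v : Fin n} xs → v ∈ xs → v ∈ₛ fromList xs
∈-fromList⁺ (x ∷ xs) (here refl) = x∈p∪q⁺ (inj₁ (x∈⁅x⁆ x))
∈-fromList⁺ (x ∷ xs) (there v∈)  = x∈p∪q⁺ {p = ⁅ x ⁆} (inj₂ (∈-fromList⁺ xs v∈))

∣⁅x⁆∪p∣ : ∀ {n} (x : Fin n) p → ¬ (x ∈ₛ p) → ∣ ⁅ x ⁆ ∪ p ∣ ≡ suc ∣ p ∣
∣⁅x⁆∪p∣ Fin.zero    (inside  ∷ p) x∉p = ⊥-elim (x∉p here)
∣⁅x⁆∪p∣ Fin.zero    (outside ∷ p) _   = cong (λ q → suc ∣ q ∣) (∪-identityˡ p)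
∣⁅x⁆∪p∣ (Fin.suc x) (inside  ∷ p) x∉p = cong suc (∣⁅x⁆∪p∣ x p (λ x∈ → x∉p (there x∈)))
∣⁅x⁆∪p∣ (Fin.suc x) (outside ∷ p) x∉p = ∣⁅x⁆∪p∣ x p (λ x∈ → x∉p (there x∈))

∣fromList∣ : ∀ {n} {xs : List (Fin n)} → Unique xs → ∣ fromList xs ∣ ≡ length xs
∣fromList∣ {n} {[]}     _          = ∣⊥∣≡0 n
∣fromList∣ {n} {x ∷ xs} (x∉ ∷ u) =
  trans (∣⁅x⁆∪p∣ x (fromList xs) λ x∈ → All.lookup x∉ (∈-fromList⁻ xs x∈) refl) (cong suc (∣fromList∣ u))

-- Direction of the arc leaving position k of an alternating path whose first arc has direction d.
flipped : ℕ → Bool → Bool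
flipped zero    d = d
flipped (suc k) d = flipped k (not d)

module _ {n} (A : Arcs n) where

  Alternating-++⁻ : ∀ d xs w ys → Alternating A d (xs ++ w ∷ ys) →
                    Alternating A d (xs ++ [ w ]) × Alternating A (flipped (length xs) d) (w ∷ ys)
  Alternating-++⁻ d []           w ys alt         = tt , alt
  Alternating-++⁻ d (x ∷ [])     w ys (arc , alt) = (arc , tt) , alt
  Alternating-++⁻ d (x ∷ y ∷ xs) w ys (arc , alt) with Alternating-++⁻ (not d) (y ∷ xs) w ys alt
  ... | alt₁ , alt₂ = (arc , alt₁) , alt₂

  Alternating-++⁺ : ∀ d xs w ys → Alternating A d (xs ++ [ w ]) →
                    Alternating A (flipped (length xs) d) (w ∷ ys) → Alternating A d (xs ++ w ∷ ys)
  Alternating-++⁺ d []           w ys _             alt₂ = alt₂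
  Alternating-++⁺ d (x ∷ [])     w ys (arc , _)    alt₂ = arc , alt₂
  Alternating-++⁺ d (x ∷ y ∷ xs) w ys (arc , alt₁) alt₂ = arc , Alternating-++⁺ (not d) (y ∷ xs) w ys alt₁ alt₂

module _ {n} {A : Arcs n} (kat : KAntiTraceable 4 A) where

  spanning-path : ∀ {ys} → Unique ys → length ys ≡ 4 →
                  ∃ λ xs → AntiDirectedPath A xs × xs ⊆ ys × length xs ≡ 4
  spanning-path {ys} uys |ys| with proj₂ kat (fromList ys) (trans (∣fromList∣ uys) |ys|)
  ... | xs , adp@(uxs , _) , xs⇔ys = xs , adp , xs⊆ys ,
    ≤-antisym (subst (length xs ≤_) |ys| (Unique⊆⇒length≤ uxs xs⊆ys))
              (subst (_≤ length xs) |ys| (Unique⊆⇒length≤ uys ys⊆xs))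
    where
    xs⊆ys : xs ⊆ ys
    xs⊆ys v∈ = ∈-fromList⁻ ys (Equivalence.to (xs⇔ys _) v∈)
    ys⊆xs : ys ⊆ xs
    ys⊆xs v∈ = Equivalence.from (xs⇔ys _) (∈-fromList⁺ ys v∈)

4≤length-longest : ∀ {n} {A : Arcs n} → KAntiTraceable 4 A → ∀ {P} → Longest A P → 4 ≤ length P
4≤length-longest kat@(s≤s (s≤s (s≤s (s≤s _))) , _) longest =
  let xs , adp , _ , |xs| = spanning-path kat distinct refl in subst (_≤ _) |xs| (longest xs adp)
  where
  distinct : Unique (Fin.zero ∷ Fin.suc Fin.zero ∷ Fin.suc (Fin.suc Fin.zero) ∷ Fin.suc (Fin.suc (Fin.suc Fin.zero)) ∷ [])
  distinct = ((λ ()) ∷ (λ ()) ∷ (λ ()) ∷ []) ∷ ((λ ()) ∷ (λ ()) ∷ []) ∷ ((λ ()) ∷ []) ∷ [] ∷ []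

module Maximality {n} {A : Arcs n} {u v₁ v₂ w vₛ : Fin n} {M : List (Fin n)} {b : Bool}
  (uP-unique : Unique (u ∷ v₁ ∷ v₂ ∷ M ++ w ∷ vₛ ∷ []))
  (P-alternating : Alternating A b (v₁ ∷ v₂ ∷ M ++ w ∷ vₛ ∷ []))
  (P-longest : Longest A (v₁ ∷ v₂ ∷ M ++ w ∷ vₛ ∷ []))
  where

  P : List (Fin n)
  P = v₁ ∷ v₂ ∷ M ++ w ∷ vₛ ∷ []

  c : Bool
  c = flipped (length (v₁ ∷ v₂ ∷ M)) b

  first-arc : DirArc A b v₁ v₂
  first-arc = proj₁ P-alternating

  init-alternating : Alternating A b ((v₁ ∷ v₂ ∷ M) ++ [ w ])
  init-alternating = proj₁ (Alternating-++⁻ A b (v₁ ∷ v₂ ∷ M) w [ vₛ ] P-alternating)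

  last-arc : DirArc A c w vₛ
  last-arc = proj₁ (proj₂ (Alternating-++⁻ A b (v₁ ∷ v₂ ∷ M) w [ vₛ ] P-alternating))

  no-longer-path : ∀ {T} d → T ↭ u ∷ P → ¬ Alternating A d T
  no-longer-path d T↭uP alt = 1+n≰n (subst (_≤ length P) (↭-length T↭uP)
    (P-longest _ (Unique-resp-↭ (setoid _) (↭⇒↭ₛ (↭-sym T↭uP)) uP-unique , d , alt)))

  tail-↭ : ∀ {R} → R ↭ u ∷ w ∷ vₛ ∷ [] → (v₁ ∷ v₂ ∷ M) ++ R ↭ u ∷ P
  tail-↭ R↭ = ↭-trans (++⁺ˡ (v₁ ∷ v₂ ∷ M) R↭) (shift u (v₁ ∷ v₂ ∷ M) (w ∷ vₛ ∷ []))

  ¬extend-start : ¬ DirArc A (not b) u v₁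
  ¬extend-start arc = no-longer-path (not b) ↭-refl
    (arc , subst (λ d → Alternating A d P) (sym (not-involutive b)) P-alternating)

  ¬insert-second : DirArc A (not b) v₁ u → DirArc A b u v₂ → ⊥
  ¬insert-second arc₁ arc₂ = no-longer-path (not b) (↭-swap v₁ u ↭-refl)
    (arc₁ , subst (λ d → DirArc A d u v₂ × Alternating A (not d) (v₂ ∷ M ++ w ∷ vₛ ∷ []))
                  (sym (not-involutive b)) (arc₂ , proj₂ P-alternating))

  ¬insert-penultimate : DirArc A c w u → DirArc A (not c) u vₛ → ⊥
  ¬insert-penultimate arc₁ arc₂ = no-longer-path b (tail-↭ (shift u [ w ] [ vₛ ]))
    (Alternating-++⁺ A b (v₁ ∷ v₂ ∷ M) w (u ∷ vₛ ∷ []) init-alternating (arc₁ , arc₂ , tt))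

  ¬extend-end : ¬ DirArc A (not c) vₛ u
  ¬extend-end arc = no-longer-path b (tail-↭ (shift u (w ∷ vₛ ∷ []) []))
    (Alternating-++⁺ A b (v₁ ∷ v₂ ∷ M) w (vₛ ∷ u ∷ []) init-alternating (last-arc , arc , tt))

  ¬reroute : DirArc A b vₛ v₂ → DirArc A c w v₁ → DirArc A (not c) v₁ u → ⊥
  ¬reroute arc₁ arc₂ arc₃ = no-longer-path b reroute↭
    (arc₁ , Alternating-++⁺ A (not b) (v₂ ∷ M) w (v₁ ∷ u ∷ []) (proj₂ init-alternating) (arc₂ , arc₃ , tt))
    where
    open PermutationReasoning
    reroute↭ : vₛ ∷ v₂ ∷ M ++ w ∷ v₁ ∷ u ∷ [] ↭ u ∷ P
    reroute↭ = begin
      vₛ ∷ v₂ ∷ M ++ w ∷ v₁ ∷ u ∷ []  ↭⟨ shifts [ vₛ ] (v₂ ∷ M) ⟩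
      v₂ ∷ M ++ vₛ ∷ w ∷ v₁ ∷ u ∷ []  ↭⟨ ++⁺ˡ (v₂ ∷ M) (↭-sym (↭-reverse (vₛ ∷ w ∷ v₁ ∷ u ∷ []))) ⟩
      v₂ ∷ M ++ u ∷ v₁ ∷ w ∷ vₛ ∷ []  ↭⟨ shifts (v₂ ∷ M) (u ∷ v₁ ∷ []) ⟩
      u ∷ P                            ∎

Label : Set
Label = Fin 5

pattern U  = Fin.zero
pattern V₁ = Fin.suc U
pattern V₂ = Fin.suc V₁
pattern W  = Fin.suc V₂
pattern Vₛ = Fin.suc W

Arc : Set
Arc = Label × Label

dirArc : Bool → Label → Label → Arc
dirArc true  i j = i , j
dirArc false i j = j , i

pathArcs : Bool → List Label → List Arc
pathArcs d []           = []
pathArcs d (i ∷ [])     = []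
pathArcs d (i ∷ j ∷ is) = dirArc d i j ∷ pathArcs (not d) (j ∷ is)

initialArcs : Bool → Bool → List Arc
initialArcs b c = dirArc b V₁ V₂ ∷ dirArc c W Vₛ ∷ []

-- Arc sets that would yield an anti-directed path longer than P (b, c: directions of the first and last arc of P).
obstructions : Bool → Bool → List (List Arc)
obstructions b c =
  (dirArc (not b) U V₁ ∷ []) ∷
  (dirArc (not b) V₁ U ∷ dirArc b U V₂ ∷ []) ∷
  (dirArc c W U ∷ dirArc (not c) U Vₛ ∷ []) ∷
  (dirArc (not c) Vₛ U ∷ []) ∷
  (dirArc b Vₛ V₂ ∷ dirArc c W V₁ ∷ dirArc (not c) V₁ U ∷ []) ∷ []

fourSets : List (List Label)
fourSets = (U ∷ V₁ ∷ V₂ ∷ Vₛ ∷ []) ∷ (U ∷ V₁ ∷ W ∷ Vₛ ∷ []) ∷ (V₁ ∷ V₂ ∷ W ∷ Vₛ ∷ []) ∷ []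

Settles : Bool → Bool → List Arc → Set
Settles b c K = ((V₁ , Vₛ) ∈ K ⊎ (Vₛ , V₁) ∈ K) ⊎ (Any (λ a → swap a ∈ K) K ⊎ Any (All (_∈ K)) (obstructions b c))

-- K: arcs known to lie in D. Branch over the anti-directed Hamiltonian paths of each 4-set of Ss in turn.
Decided : Bool → Bool → List (List Label) → List Arc → Set
Decided b c []       K = Settles b c K
Decided b c (S ∷ Ss) K = Settles b c K ⊎
  All (λ q → Unique q → Decided b c Ss (pathArcs true q ++ K) × Decided b c Ss (pathArcs false q ++ K)) (words 4 S)

module _ where
  open DecMembership (≡-dec (_≟_ {5}) (_≟_ {5})) using (_∈?_)
  open import Data.List.Relation.Unary.Unique.DecPropositional (_≟_ {5}) using (unique?)

  settles? : ∀ b c K → Dec (Settles b c K)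
  settles? b c K = ((V₁ , Vₛ) ∈? K ⊎-dec (Vₛ , V₁) ∈? K) ⊎-dec
                   (any? (λ a → swap a ∈? K) K ⊎-dec any? (all? (_∈? K)) (obstructions b c))

  decided? : ∀ b c Ss K → Dec (Decided b c Ss K)
  decided? b c []       K = settles? b c K
  decided? b c (S ∷ Ss) K = settles? b c K ⊎-dec
    all? (λ q → unique? q →-dec (decided? b c Ss (pathArcs true q ++ K) ×-dec decided? b c Ss (pathArcs false q ++ K))) (words 4 S)

  fourSets-distinct : All (λ S → Unique S × length S ≡ 4) fourSets
  fourSets-distinct = from-yes (all? (λ S → unique? S ×-dec (length S ≟ℕ 4)) fourSets)

  certificate : ∀ b c → Decided b c fourSets (initialArcs b c)
  certificate b c = toWitness {a? = decided? b c fourSets (initialArcs b c)} (by-evaluation b c)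
    where
    by-evaluation : ∀ b c → True (decided? b c fourSets (initialArcs b c))
    by-evaluation true  true  = tt
    by-evaluation true  false = tt
    by-evaluation false true  = tt
    by-evaluation false false = tt

module Interpretation {n} (A : Arcs n) (lab : Label → Fin n) where

  Holds : Arc → Set
  Holds a = A (lab (proj₁ a)) (lab (proj₂ a))

  Sound : List Arc → Set
  Sound = All Holds

  DirArc⇒Holds : ∀ d {i j} → DirArc A d (lab i) (lab j) → Holds (dirArc d i j)
  DirArc⇒Holds true  arc = arc
  DirArc⇒Holds false arc = arc

  Holds⇒DirArc : ∀ d {i j} → Holds (dirArc d i j) → DirArc A d (lab i) (lab j)
  Holds⇒DirArc true  h = h
  Holds⇒DirArc false h = h

  pathArcs-sound : ∀ d q → Alternating A d (map lab q) → Sound (pathArcs d q)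
  pathArcs-sound d []          _           = []
  pathArcs-sound d (i ∷ [])    _           = []
  pathArcs-sound d (i ∷ j ∷ q) (arc , alt) = DirArc⇒Holds d arc ∷ pathArcs-sound (not d) (j ∷ q) alt

  Witnessed : List Label → Set
  Witnessed S = ∃ λ q → q ∈ words 4 S × Unique q × ∃ λ d → Sound (pathArcs d q)

  witnessed : KAntiTraceable 4 A → (∀ {i j} → lab i ≡ lab j → i ≡ j) →
              ∀ {S} → Unique S × length S ≡ 4 → Witnessed S
  witnessed kat lab-injective {S} (uS , |S|)
    with xs , (uxs , d , alt) , xs⊆S , |xs| ← spanning-path kat (map⁺ lab-injective uS) (trans (length-map lab S) |S|)
    with q , refl , q⊆S ← ⊆-map⇒map xs xs⊆S
    = q , subst (λ k → q ∈ words k S) (trans (sym (length-map lab q)) |xs|) (∈-words S q⊆S) ,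
      map⁻ uxs , d , pathArcs-sound d q alt

  module _ (oriented : Oriented A) {b c} (excluded : All (λ F → ¬ Sound F) (obstructions b c)) where

    settles-sound : ∀ {K} → Settles b c K → Sound K → Adjacent A (lab V₁) (lab Vₛ)
    settles-sound (inj₁ (inj₁ arc)) sK = inj₁ (All.lookup sK arc)
    settles-sound (inj₁ (inj₂ arc)) sK = inj₂ (All.lookup sK arc)
    settles-sound (inj₂ (inj₁ digon)) sK with h , back ← All.lookupAny sK digon =
      ⊥-elim (proj₂ oriented _ _ h (All.lookup sK back))
    settles-sound (inj₂ (inj₂ obstructed)) sK with ¬sF , F⊆K ← All.lookupAny excluded obstructed =
      ⊥-elim (¬sF (All.map (All.lookup sK) F⊆K))

    decided-sound : ∀ {Ss K} → All Witnessed Ss → Decided b c Ss K → Sound K → Adjacent A (lab V₁) (lab Vₛ)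
    decided-sound []       settled  sK = settles-sound settled sK
    decided-sound (_ ∷ _) (inj₁ settled) sK = settles-sound settled sK
    decided-sound {_ ∷ Ss} {K} ((q , q∈ , uq , d , sq) ∷ ws) (inj₂ branches) sK =
      decided-sound ws (branch d (All.lookup branches q∈ uq)) (All-++⁺ sq sK)
      where
      branch : ∀ d → Decided b c Ss (pathArcs true q ++ K) × Decided b c Ss (pathArcs false q ++ K) →
               Decided b c Ss (pathArcs d q ++ K)
      branch true  = proj₁
      branch false = proj₂

endpoints-adjacent : ∀ {n} {A : Arcs n} → Oriented A → KAntiTraceable 4 A →
  ∀ {u P} → u ∉ P → AntiDirectedPath A P → Longest A P →
  ∀ {v₁ v₂ M w vₛ} → P ≡ v₁ ∷ v₂ ∷ M ++ w ∷ vₛ ∷ [] → Adjacent A v₁ vₛ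
endpoints-adjacent {A = A} oriented kat {u} u∉P (P-unique , b , alt) longest {v₁} {v₂} {M} {w} {vₛ} refl =
  decided-sound oriented excluded (All.map (witnessed kat lab-injective) fourSets-distinct)
    (certificate b c) (DirArc⇒Holds b first-arc ∷ DirArc⇒Holds c last-arc ∷ [])
  where
  uP-unique : Unique (u ∷ v₁ ∷ v₂ ∷ M ++ w ∷ vₛ ∷ [])
  uP-unique = ¬Any⇒All¬ _ u∉P ∷ P-unique
  open Maximality uP-unique alt longest
  lab : Label → Fin _
  lab = lookup (u ∷ v₁ ∷ v₂ ∷ w ∷ vₛ ∷ [])
  lab-injective : ∀ {i j} → lab i ≡ lab j → i ≡ j
  lab-injective = lookup-injective (Unique-drop-middle (u ∷ v₁ ∷ v₂ ∷ []) M uP-unique)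
  open Interpretation A lab
  excluded : All (λ F → ¬ Sound F) (obstructions b c)
  excluded = (λ { (h ∷ []) → ¬extend-start (Holds⇒DirArc (not b) h) })
           ∷ (λ { (h₁ ∷ h₂ ∷ []) → ¬insert-second (Holds⇒DirArc (not b) h₁) (Holds⇒DirArc b h₂) })
           ∷ (λ { (h₁ ∷ h₂ ∷ []) → ¬insert-penultimate (Holds⇒DirArc c h₁) (Holds⇒DirArc (not c) h₂) })
           ∷ (λ { (h ∷ []) → ¬extend-end (Holds⇒DirArc (not c) h) })
           ∷ (λ { (h₁ ∷ h₂ ∷ h₃ ∷ []) → ¬reroute (Holds⇒DirArc b h₁) (Holds⇒DirArc c h₂) (Holds⇒DirArc (not c) h₃) })
           ∷ []

lemma1 : (n : ℕ) (A : Arcs n) → Oriented A → KAntiTraceable 4 A →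
    (P : List⁺ _) → AntiDirectedPath A (toList P) →
    (∀ Q → AntiDirectedPath A Q → length Q ≤ length (toList P)) →
    length (toList P) < n →
    Adjacent A (head P) (last P)
lemma1 n A oriented kat P adp longest short
  with v₂ , M , w , P-shape ← four-ends P (4≤length-longest kat {toList P} longest)
  with u , u∉P ← ∃-∉ (toList P) short
  = endpoints-adjacent oriented kat u∉P adp longest P-shape
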